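{- Let $a,b,i,j,k$ be pairwise distinct agents and let $S$ be the forwarding network consisting of the lists $(a,i,b)$, $(a,j,b)$, $(a,k,b)$ together with all their contiguous non-empty sublists. Let $\mathsf{P}:\mathbb{A}\to\mathbb{F}$ be a predicate on agents. Then \[\vdash\ \mathtt{2of3}\big(\mathcal{T}^1_{a\leftarrow i}(\mathsf{P}),\mathcal{T}^1_{a\leftarrow j}(\mathsf{P}),\mathcal{T}^1_{a\leftarrow k}(\mathsf{P})\big)\wedge\mathtt{2of3}\big(\mathcal{I}_{a\leftarrow i}\mathcal{V}^0_{i\leftarrow b}(\mathsf{P}),\mathcal{I}_{a\leftarrow j}\mathcal{V}^0_{j\leftarrow b}(\mathsf{P}),\mathcal{I}_{a\leftarrow k}\mathcal{V}^0_{k\leftarrow b}(\mathsf{P})\big)\Rightarrow\mathcal{T}^0_{a\leftarrow b}(\mathsf{P}).\]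
   Context: Setting: finite set of agents $\mathbb{A}$ with preorder $\sqsubseteq$; modalities $\mathcal{B}_a$, $\mathcal{I}_{a\leftarrow b}$ and $\Box$; $\mathbb{F}$ is the set of formulas $A,B::=\top\mid\bot\mid t\mid\mathcal{M}A\mid A\Rightarrow B\mid A\wedge B\mid A\vee B$ (finite conjunctions allowed). $\vdash$ is provability in intuitionistic propositional logic with K ($\mathcal{M}A\Rightarrow\mathcal{M}(A\Rightarrow B)\Rightarrow\mathcal{M}B$) and necessitation for every modality, plus schemes $\mathcal{B}_aA\Rightarrow\mathcal{B}_a\mathcal{B}_aA$, $\mathcal{I}_{a\leftarrow b}A\Rightarrow\mathcal{B}_a\mathcal{I}_{a\leftarrow b}A$, $\mathcal{I}_{a\leftarrow b}A\Rightarrow\mathcal{I}_{a\leftarrow b}\mathcal{B}_bA$, for $a\sqsubseteq b$: $\mathcal{B}_aA\Rightarrow\mathcal{B}_bA$, $\mathcal{I}_{a\leftarrow c}A\Rightarrow\mathcal{I}_{b\leftarrow c}A$, $\mathcal{I}_{c\leftarrow a}A\Rightarrow\mathcal{I}_{c\leftarrow b}A$; $\Box A\Rightarrow\mathcal{M}\Box A$; $\Box A\Rightarrow A$. With $\mathcal{I}_{x_1\leftarrow\cdots\leftarrow x_k}:=\mathcal{I}_{x_1\leftarrow x_2}\cdots\mathcal{I}_{x_{k-1}\leftarrow x_k}$, define $\mathcal{J}_{x\leftarrow y}A:=\bigwedge\{\mathcal{I}_{x\leftarrow\gamma\leftarrow y}A\mid(x,\gamma,y)\in S\}$ (empty conjunction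 $=\top$) and $\widehat{\mathcal{J}_{x\leftarrow y}}A:=(\mathcal{J}_{x\leftarrow y}A\Rightarrow A)$. Sets $\mathbf{C}^0_x(\mathsf{P}):=\{\mathsf{P}(x)\}$, $\mathbf{C}^{n+1}_x(\mathsf{P}):=\{\widehat{\mathcal{J}_{x\leftarrow y}}A,\ \mathcal{J}_{x\leftarrow y}A\mid y\in\mathbb{A},A\in\mathbf{C}^n_y(\mathsf{P})\}$; $n$-th order validity $\mathcal{V}^n_{x\leftarrow y}(\mathsf{P}):=\bigwedge\{\widehat{\mathcal{J}_{x\leftarrow y}}A\mid A\in\mathbf{C}^n_y(\mathsf{P})\}$; $n$-th order trust $\mathcal{T}^n_{x\leftarrow y}(\mathsf{P}):=\mathcal{B}_x\mathcal{V}^n_{x\leftarrow y}(\mathsf{P})$. For formulas $A,B,C$: $\mathtt{2of3}(A,B,C):=(A\wedge B)\vee(A\wedge C)\vee(B\wedge C)$. -}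

module Defs where

open import Data.Nat using (ℕ; zero; suc)
open import Data.Fin using (Fin; _≟_)
open import Data.List using (List; []; _∷_; _++_; map; concatMap)
open import Data.Bool using (Bool; true; false; _∧_)
open import Relation.Nullary.Decidable using (⌊_⌋)
import Data.List.Base as LB
import Data.List.Base

data Mod (n : ℕ) : Set where
  𝓑 : Fin n → Mod n
  𝓘 : Fin n → Fin n → Mod n      -- 𝓘 a b  is  I_{a←b}
  □ : Mod n

infixr 4 _⇒_
infixr 5 _∨'_
infixr 6 _∧'_
infixr 7 ⟨_⟩_

data Form (At : Set) (n : ℕ) : Set where
  ⊤' ⊥' : Form At n
  atom  : At → Form At n
  ⟨_⟩_  : Mod n → Form At n → Form At n
  _⇒_   : Form At n → Form At n → Form At n
  _∧'_  : Form At n → Form At n → Form At n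
  _∨'_  : Form At n → Form At n → Form At n

⋀ : ∀ {At n} → List (Form At n) → Form At n
⋀ []       = ⊤'
⋀ (A ∷ As) = A ∧' ⋀ As

module Logic {At : Set} {n : ℕ} (_⊑_ : Fin n → Fin n → Set) where

  infix 2 ⊢_

  data ⊢_ : Form At n → Set where
    ax-K    : ∀ {A B} → ⊢ A ⇒ B ⇒ A
    ax-S    : ∀ {A B C} → ⊢ (A ⇒ B ⇒ C) ⇒ (A ⇒ B) ⇒ A ⇒ C
    ax-∧E₁  : ∀ {A B} → ⊢ A ∧' B ⇒ A
    ax-∧E₂  : ∀ {A B} → ⊢ A ∧' B ⇒ B
    ax-∧I   : ∀ {A B} → ⊢ A ⇒ B ⇒ A ∧' B
    ax-∨I₁  : ∀ {A B} → ⊢ A ⇒ A ∨' B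
    ax-∨I₂  : ∀ {A B} → ⊢ B ⇒ A ∨' B
    ax-∨E   : ∀ {A B C} → ⊢ (A ⇒ C) ⇒ (B ⇒ C) ⇒ A ∨' B ⇒ C
    ax-⊥E   : ∀ {A} → ⊢ ⊥' ⇒ A
    ax-⊤I   : ⊢ ⊤'
    mp      : ∀ {A B} → ⊢ A ⇒ B → ⊢ A → ⊢ B
    ax-Kₘ   : ∀ {M A B} → ⊢ ⟨ M ⟩ A ⇒ ⟨ M ⟩ (A ⇒ B) ⇒ ⟨ M ⟩ B
    nec     : ∀ {M A} → ⊢ A → ⊢ ⟨ M ⟩ A
    ax-BB   : ∀ {a A} → ⊢ ⟨ 𝓑 a ⟩ A ⇒ ⟨ 𝓑 a ⟩ ⟨ 𝓑 a ⟩ A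
    ax-IBI  : ∀ {a b A} → ⊢ ⟨ 𝓘 a b ⟩ A ⇒ ⟨ 𝓑 a ⟩ ⟨ 𝓘 a b ⟩ A
    ax-IIB  : ∀ {a b A} → ⊢ ⟨ 𝓘 a b ⟩ A ⇒ ⟨ 𝓘 a b ⟩ ⟨ 𝓑 b ⟩ A
    ax-B⊑   : ∀ {a b A} → a ⊑ b → ⊢ ⟨ 𝓑 a ⟩ A ⇒ ⟨ 𝓑 b ⟩ A
    ax-I⊑ˡ  : ∀ {a b c A} → a ⊑ b → ⊢ ⟨ 𝓘 a c ⟩ A ⇒ ⟨ 𝓘 b c ⟩ A
    ax-I⊑ʳ  : ∀ {a b c A} → a ⊑ b → ⊢ ⟨ 𝓘 c a ⟩ A ⇒ ⟨ 𝓘 c b ⟩ A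
    ax-□M   : ∀ {M A} → ⊢ ⟨ □ ⟩ A ⇒ ⟨ M ⟩ ⟨ □ ⟩ A
    ax-□T   : ∀ {A} → ⊢ ⟨ □ ⟩ A ⇒ A

prefixes⁺ : ∀ {A : Set} → List A → List (List A)
prefixes⁺ []       = []
prefixes⁺ (x ∷ xs) = (x ∷ []) ∷ map (x ∷_) (prefixes⁺ xs)

infixes⁺ : ∀ {A : Set} → List A → List (List A)
infixes⁺ []       = []
infixes⁺ (x ∷ xs) = prefixes⁺ (x ∷ xs) ++ infixes⁺ xs

net3 : ∀ {n} (a b i j k : Fin n) → List (List (Fin n))
net3 a b i j k =
  concatMap infixes⁺ ((a ∷ i ∷ b ∷ []) ∷ (a ∷ j ∷ b ∷ []) ∷ (a ∷ k ∷ b ∷ []) ∷ [])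

𝓘chain : ∀ {At n} → List (Fin n) → Form At n → Form At n
𝓘chain (x ∷ z ∷ rest) A = ⟨ 𝓘 x z ⟩ 𝓘chain (z ∷ rest) A
𝓘chain _              A = A

last' : ∀ {n} → Fin n → List (Fin n) → Fin n
last' z []       = z
last' _ (w ∷ ws) = last' w ws

isPath : ∀ {n} → Fin n → Fin n → List (Fin n) → Bool
isPath x y (h ∷ z ∷ rest) = ⌊ h ≟ x ⌋ ∧ ⌊ last' z rest ≟ y ⌋
isPath x y _              = false

𝓙 : ∀ {At n} → List (List (Fin n)) → Fin n → Fin n → Form At n → Form At n
𝓙 S x y A = ⋀ (map (λ ℓ → 𝓘chain ℓ A) (LB.filterᵇ (isPath x y) S))

𝓙̂ : ∀ {At n} → List (List (Fin n)) → Fin n → Fin n → Form At n → Form At n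
𝓙̂ S x y A = 𝓙 S x y A ⇒ A

𝐂 : ∀ {At n} → List (List (Fin n)) → ℕ → Fin n → (Fin n → Form At n) → List (Form At n)
𝐂 S zero    x P = P x ∷ []
𝐂 {n = n} S (suc m) x P =
  concatMap (λ y → concatMap (λ A → 𝓙̂ S x y A ∷ 𝓙 S x y A ∷ []) (𝐂 S m y P))
            (Data.List.Base.allFin n)

𝓥 : ∀ {At n} → List (List (Fin n)) → ℕ → Fin n → Fin n → (Fin n → Form At n) → Form At n
𝓥 S m x y P = ⋀ (map (𝓙̂ S x y) (𝐂 S m y P))

𝓣 : ∀ {At n} → List (List (Fin n)) → ℕ → Fin n → Fin n → (Fin n → Form At n) → Form At n
𝓣 S m x y P = ⟨ 𝓑 x ⟩ 𝓥 S m x y P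

twoOf3 : ∀ {At n} → Form At n → Form At n → Form At n → Form At n
twoOf3 A B C = (A ∧' B) ∨' (A ∧' C) ∨' (B ∧' C)

-- Of the two-of-three trusted and the two-of-three forwarding intermediaries some
-- x ∈ {i, j, k} is both.  As a, b ∉ {i, j, k}, the only paths of the network from a
-- to x and from x to b are the direct ones, so 𝓙_{a←x} and 𝓙_{x←b} are just 𝓘_{a←x}
-- and 𝓘_{x←b}.  Reason inside 𝓑_a, where 𝓘_{a←x} 𝓥⁰_{x←b} is available by 𝓘A ⇒ 𝓑𝓘A:
-- the route (a, x, b) turns 𝓙_{a←b} P(b) into 𝓘_{a←x} 𝓙_{x←b} P(b), and the
-- first-order trust clauses for 𝓙_{x←b} P(b) and 𝓙̂_{x←b} P(b) then yield
-- 𝓙_{x←b} P(b) and 𝓙_{x←b} P(b) ⇒ P(b).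
module Submission where

open import Defs
open import Data.Nat using (ℕ; suc)
open import Data.Fin using (Fin; _≟_)
open import Data.Bool using (T)
open import Data.Bool.Properties using (T-∧)
open import Data.List using (List; []; _∷_; map; concatMap; filterᵇ)
open import Data.List.Membership.Propositional using (_∈_)
open import Data.List.Membership.Propositional.Properties
  using (∈-allFin; ∈-concatMap⁺; ∈-filter⁺; ∈-filter⁻; ∈-++⁺ˡ; ∈-++⁺ʳ)
open import Data.List.Relation.Unary.All as All using (All; []; _∷_)
open import Data.List.Relation.Unary.All.Properties using (++⁺)
open import Data.List.Relation.Unary.Any as Any using (here; there)
open import Data.Empty using (⊥-elim)
open import Data.Product using (_×_; _,_)
open import Data.Sum using (_⊎_; inj₁; inj₂)
open import Function using (_∘_; Equivalence)
open import Relation.Binary.PropositionalEquality using (_≡_; _≢_; refl; sym; cong₂; ≢-sym)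
open import Relation.Binary.Structures using (IsPreorder)
open import Relation.Nullary.Decidable using (T?; toWitness; fromWitness)

concatMap-∈ : ∀ {A B : Set} {f : A → List B} {x xs y} → x ∈ xs → y ∈ f x → y ∈ concatMap f xs
concatMap-∈ {f = f} x∈xs y∈fx = ∈-concatMap⁺ f (Any.map (λ { refl → y∈fx }) x∈xs)

module _ {At : Set} {n : ℕ} {S : List (List (Fin n))} {P : Fin n → Form At n} where

  𝓙̂∈𝐂 : ∀ {m x y A} → A ∈ 𝐂 S m y P → 𝓙̂ S x y A ∈ 𝐂 S (suc m) x P
  𝓙̂∈𝐂 {y = y} A∈ = concatMap-∈ (∈-allFin y) (concatMap-∈ A∈ (here refl))

  𝓙∈𝐂 : ∀ {m x y A} → A ∈ 𝐂 S m y P → 𝓙 S x y A ∈ 𝐂 S (suc m) x P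
  𝓙∈𝐂 {y = y} A∈ = concatMap-∈ (∈-allFin y) (concatMap-∈ A∈ (there (here refl)))

module _ {n : ℕ} where

  isPath-ends : ∀ {x y h z : Fin n} {rest} →
                T (isPath x y (h ∷ z ∷ rest)) → h ≡ x × last' z rest ≡ y
  isPath-ends {x} {y} {h} {z} {rest} t with Equivalence.to T-∧ t
  ... | h≟x , z≟y = toWitness {a? = h ≟ x} h≟x , toWitness {a? = last' z rest ≟ y} z≟y

  isPath-route : ∀ (a c b : Fin n) → T (isPath a b (a ∷ c ∷ b ∷ []))
  isPath-route a c b =
    Equivalence.from T-∧ (fromWitness {a? = a ≟ a} refl , fromWitness {a? = b ≟ b} refl)

  PathsOf : List (List (Fin n)) → Fin n → Fin n → List (List (Fin n))
  PathsOf S x y = filterᵇ (isPath x y) S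

  SolePath : List (List (Fin n)) → Fin n → Fin n → Set
  SolePath S x y = ∀ {ℓ} → ℓ ∈ PathsOf S x y → ℓ ≡ x ∷ y ∷ []

  -- Coarse shapes of the sublists of a route (a, c, b); only a route can have length 3.
  data Segment (a b : Fin n) : List (Fin n) → Set where
    single : ∀ h → Segment a b (h ∷ [])
    hop    : ∀ h z → Segment a b (h ∷ z ∷ [])
    route  : ∀ c → Segment a b (a ∷ c ∷ b ∷ [])

  infixes⁺-route-segments : ∀ (a c b : Fin n) → All (Segment a b) (infixes⁺ (a ∷ c ∷ b ∷ []))
  infixes⁺-route-segments a c b =
    single a ∷ hop a c ∷ route c ∷ single c ∷ hop c b ∷ single b ∷ []

  route∈infixes⁺ : ∀ (a c b : Fin n) → (a ∷ c ∷ b ∷ []) ∈ infixes⁺ (a ∷ c ∷ b ∷ [])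
  route∈infixes⁺ a c b = there (there (here refl))

  net3-segments : ∀ (a b i j k : Fin n) → All (Segment a b) (net3 a b i j k)
  net3-segments a b i j k =
    ++⁺ (infixes⁺-route-segments a i b)
      (++⁺ (infixes⁺-route-segments a j b) (++⁺ (infixes⁺-route-segments a k b) []))

  segment-solePath : ∀ {a b x y : Fin n} {ℓ} → x ≢ a ⊎ y ≢ b →
                     Segment a b ℓ → T (isPath x y ℓ) → ℓ ≡ x ∷ y ∷ []
  segment-solePath _ (single h) ()
  segment-solePath _ (hop h z) t =
    let h≡x , z≡y = isPath-ends {rest = []} t in cong₂ (λ u v → u ∷ v ∷ []) h≡x z≡y
  segment-solePath (inj₁ x≢a) (route c) t =
    let a≡x , _ = isPath-ends {z = c} {rest = _ ∷ []} t in ⊥-elim (x≢a (sym a≡x))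
  segment-solePath (inj₂ y≢b) (route c) t =
    let _ , b≡y = isPath-ends {z = c} {rest = _ ∷ []} t in ⊥-elim (y≢b (sym b≡y))

  segments-solePath : ∀ {S} {a b x y : Fin n} → All (Segment a b) S → x ≢ a ⊎ y ≢ b → SolePath S x y
  segments-solePath {x = x} {y} segs x≢a⊎y≢b ℓ∈ with ∈-filter⁻ (T? ∘ isPath x y) ℓ∈
  ... | ℓ∈S , t = segment-solePath x≢a⊎y≢b (All.lookup segs ℓ∈S) t

  route∈PathsOf : ∀ {S} {a c b : Fin n} → (a ∷ c ∷ b ∷ []) ∈ S → (a ∷ c ∷ b ∷ []) ∈ PathsOf S a b
  route∈PathsOf {a = a} {c} {b} r∈S = ∈-filter⁺ (T? ∘ isPath a b) r∈S (isPath-route a c b)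

module Derivations {At : Set} {n : ℕ} (_⊑_ : Fin n → Fin n → Set) where
  open Logic {At} {n} _⊑_

  ⇒-refl : ∀ {A} → ⊢ A ⇒ A
  ⇒-refl {A} = mp (mp (ax-S {A} {A ⇒ A} {A}) ax-K) ax-K

  ⇒-const : ∀ {A B} → ⊢ B → ⊢ A ⇒ B
  ⇒-const = mp ax-K

  ⇒-app : ∀ {A B C} → ⊢ A ⇒ B ⇒ C → ⊢ A ⇒ B → ⊢ A ⇒ C
  ⇒-app f g = mp (mp ax-S f) g

  infixr 9 _∘⊢_
  _∘⊢_ : ∀ {A B C} → ⊢ B ⇒ C → ⊢ A ⇒ B → ⊢ A ⇒ C
  f ∘⊢ g = ⇒-app (⇒-const f) g

  ∧-intro : ∀ {A B C} → ⊢ A ⇒ B → ⊢ A ⇒ C → ⊢ A ⇒ B ∧' C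
  ∧-intro f g = ⇒-app (ax-∧I ∘⊢ f) g

  ∧-map : ∀ {A B C D} → ⊢ A ⇒ C → ⊢ B ⇒ D → ⊢ A ∧' B ⇒ C ∧' D
  ∧-map f g = ∧-intro (f ∘⊢ ax-∧E₁) (g ∘⊢ ax-∧E₂)

  ∨-elim : ∀ {A B C} → ⊢ A ⇒ C → ⊢ B ⇒ C → ⊢ A ∨' B ⇒ C
  ∨-elim f g = mp (mp ax-∨E f) g

  ∨-elimᶜ : ∀ {Γ A B C} → ⊢ Γ ⇒ A ⇒ C → ⊢ Γ ⇒ B ⇒ C → ⊢ Γ ⇒ A ∨' B ⇒ C
  ∨-elimᶜ f g = ⇒-app (⇒-app (⇒-const ax-∨E) f) g

  curry : ∀ {A B C} → ⊢ A ∧' B ⇒ C → ⊢ A ⇒ B ⇒ C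
  curry f = ⇒-app (⇒-const (mp ax-S (⇒-const f))) ax-∧I

  uncurry : ∀ {A B C} → ⊢ A ⇒ B ⇒ C → ⊢ A ∧' B ⇒ C
  uncurry f = ⇒-app (f ∘⊢ ax-∧E₁) ax-∧E₂

  ⟨⟩-mono : ∀ {M A B} → ⊢ A ⇒ B → ⊢ ⟨ M ⟩ A ⇒ ⟨ M ⟩ B
  ⟨⟩-mono f = ⇒-app ax-Kₘ (⇒-const (nec f))

  ⟨⟩-∧ : ∀ {M A B} → ⊢ ⟨ M ⟩ A ∧' ⟨ M ⟩ B ⇒ ⟨ M ⟩ (A ∧' B)
  ⟨⟩-∧ = ⇒-app (⇒-app (⇒-const ax-Kₘ) ax-∧E₂) (⟨⟩-mono ax-∧I ∘⊢ ax-∧E₁)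

  ⋀-intro : ∀ {B : Set} {f : B → Form At n} {A xs} →
            (∀ {x} → x ∈ xs → ⊢ A ⇒ f x) → ⊢ A ⇒ ⋀ (map f xs)
  ⋀-intro {xs = []}     _   = ⇒-const ax-⊤I
  ⋀-intro {xs = _ ∷ _} prf = ∧-intro (prf (here refl)) (⋀-intro (prf ∘ there))

  ⋀-elim : ∀ {B : Set} {f : B → Form At n} {x xs} → x ∈ xs → ⊢ ⋀ (map f xs) ⇒ f x
  ⋀-elim (here refl) = ax-∧E₁
  ⋀-elim (there x∈)  = ⋀-elim x∈ ∘⊢ ax-∧E₂

  module _ {A₁ A₂ A₃ B₁ B₂ B₃ : Form At n} where

    twoOf3-meet : ⊢ twoOf3 A₁ A₂ A₃ ∧' twoOf3 B₁ B₂ B₃ ⇒ (A₁ ∧' B₁) ∨' (A₂ ∧' B₂) ∨' (A₃ ∧' B₃)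
    twoOf3-meet =
      uncurry (∨-elim (∨-elimᶜ (at₁ ax-∧E₁ ax-∧E₁) (∨-elimᶜ (at₁ ax-∧E₁ ax-∧E₁) (at₂ ax-∧E₂ ax-∧E₁)))
              (∨-elim (∨-elimᶜ (at₁ ax-∧E₁ ax-∧E₁) (∨-elimᶜ (at₁ ax-∧E₁ ax-∧E₁) (at₃ ax-∧E₂ ax-∧E₂)))
                      (∨-elimᶜ (at₂ ax-∧E₁ ax-∧E₂) (∨-elimᶜ (at₃ ax-∧E₂ ax-∧E₂) (at₂ ax-∧E₁ ax-∧E₁)))))
      where
      Meet : Form At n
      Meet = (A₁ ∧' B₁) ∨' (A₂ ∧' B₂) ∨' (A₃ ∧' B₃)
      at₁ : ∀ {X Y} → ⊢ X ⇒ A₁ → ⊢ Y ⇒ B₁ → ⊢ X ⇒ Y ⇒ Meet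
      at₁ p q = curry (ax-∨I₁ ∘⊢ ∧-map p q)
      at₂ : ∀ {X Y} → ⊢ X ⇒ A₂ → ⊢ Y ⇒ B₂ → ⊢ X ⇒ Y ⇒ Meet
      at₂ p q = curry (ax-∨I₂ ∘⊢ ax-∨I₁ ∘⊢ ∧-map p q)
      at₃ : ∀ {X Y} → ⊢ X ⇒ A₃ → ⊢ Y ⇒ B₃ → ⊢ X ⇒ Y ⇒ Meet
      at₃ p q = curry (ax-∨I₂ ∘⊢ ax-∨I₂ ∘⊢ ∧-map p q)

  𝓙-intro : ∀ S {x y A} → SolePath S x y → ⊢ ⟨ 𝓘 x y ⟩ A ⇒ 𝓙 S x y A
  𝓙-intro S {x} {y} {A} sole = ⋀-intro (λ ℓ∈ → direct (sole ℓ∈))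
    where
    direct : ∀ {ℓ} → ℓ ≡ x ∷ y ∷ [] → ⊢ ⟨ 𝓘 x y ⟩ A ⇒ 𝓘chain ℓ A
    direct refl = ⇒-refl

  𝓙-elim : ∀ S {x y A ℓ} → ℓ ∈ PathsOf S x y → ⊢ 𝓙 S x y A ⇒ 𝓘chain ℓ A
  𝓙-elim S = ⋀-elim

  𝓙̂-elim : ∀ S {x y A} → SolePath S x y → ⊢ 𝓙̂ S x y A ∧' ⟨ 𝓘 x y ⟩ A ⇒ A
  𝓙̂-elim S sole = ⇒-app ax-∧E₁ (𝓙-intro S sole ∘⊢ ax-∧E₂)

  relay : ∀ {S a x b} (P : Fin n → Form At n) → SolePath S a x → SolePath S x b →
          (a ∷ x ∷ b ∷ []) ∈ S → ⊢ 𝓣 S 1 a x P ∧' ⟨ 𝓘 a x ⟩ 𝓥 S 0 x b P ⇒ 𝓣 S 0 a b P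
  relay {S} {a} {x} {b} P a→x x→b r∈S =
    ⟨⟩-mono (∧-intro (curry (⇒-app valid reached)) (⇒-const ax-⊤I))
      ∘⊢ ⟨⟩-∧ ∘⊢ ∧-map (⟨⟩-mono trusted) ax-IBI
    where
    Q = P b

    trusted : ⊢ 𝓥 S 1 a x P ⇒ 𝓙̂ S a x (𝓙̂ S x b Q) ∧' 𝓙̂ S a x (𝓙 S x b Q)
    trusted = ∧-intro (⋀-elim {f = 𝓙̂ S a x} (𝓙̂∈𝐂 {S = S} {P} {0} {x} (here refl)))
                      (⋀-elim {f = 𝓙̂ S a x} (𝓙∈𝐂 {S = S} {P} {0} {x} (here refl)))

    Γ : Form At n
    Γ = ((𝓙̂ S a x (𝓙̂ S x b Q) ∧' 𝓙̂ S a x (𝓙 S x b Q)) ∧' ⟨ 𝓘 a x ⟩ 𝓥 S 0 x b P) ∧' 𝓙 S a b Q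

    reached : ⊢ Γ ⇒ 𝓙 S x b Q
    reached = 𝓙̂-elim S a→x ∘⊢ ∧-intro (ax-∧E₂ ∘⊢ ax-∧E₁ ∘⊢ ax-∧E₁)
                                      (⟨⟩-mono (𝓙-intro S x→b) ∘⊢ 𝓙-elim S (route∈PathsOf r∈S) ∘⊢ ax-∧E₂)

    valid : ⊢ Γ ⇒ 𝓙̂ S x b Q
    valid = 𝓙̂-elim S a→x ∘⊢ ∧-intro (ax-∧E₁ ∘⊢ ax-∧E₁ ∘⊢ ax-∧E₁) (⟨⟩-mono ax-∧E₁ ∘⊢ ax-∧E₂ ∘⊢ ax-∧E₁)

lemma10 : {At : Set} {n : ℕ} (_⊑_ : Fin n → Fin n → Set) → IsPreorder _≡_ _⊑_ →
          (a b i j k : Fin n) →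
          a ≢ b → a ≢ i → a ≢ j → a ≢ k → b ≢ i → b ≢ j → b ≢ k →
          i ≢ j → i ≢ k → j ≢ k →
          (P : Fin n → Form At n) →
          Logic.⊢_ _⊑_
            ((twoOf3 (𝓣 (net3 a b i j k) 1 a i P)
                     (𝓣 (net3 a b i j k) 1 a j P)
                     (𝓣 (net3 a b i j k) 1 a k P)
              ∧' twoOf3 (⟨ 𝓘 a i ⟩ 𝓥 (net3 a b i j k) 0 i b P)
                        (⟨ 𝓘 a j ⟩ 𝓥 (net3 a b i j k) 0 j b P)
                        (⟨ 𝓘 a k ⟩ 𝓥 (net3 a b i j k) 0 k b P))
             ⇒ 𝓣 (net3 a b i j k) 0 a b P)
lemma10 _⊑_ _ a b i j k _ a≢i a≢j a≢k b≢i b≢j b≢k _ _ _ P =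
  ∨-elim (via a≢i b≢i (∈-++⁺ˡ (route∈infixes⁺ a i b)))
    (∨-elim (via a≢j b≢j (∈-++⁺ʳ (infixes⁺ aib) (∈-++⁺ˡ (route∈infixes⁺ a j b))))
            (via a≢k b≢k (∈-++⁺ʳ (infixes⁺ aib) (∈-++⁺ʳ (infixes⁺ ajb) (∈-++⁺ˡ (route∈infixes⁺ a k b))))))
    ∘⊢ twoOf3-meet
  where
  open Logic _⊑_
  open Derivations _⊑_
  S = net3 a b i j k
  aib = a ∷ i ∷ b ∷ []
  ajb = a ∷ j ∷ b ∷ []

  via : ∀ {x} → a ≢ x → b ≢ x → (a ∷ x ∷ b ∷ []) ∈ S →
        ⊢ 𝓣 S 1 a x P ∧' ⟨ 𝓘 a x ⟩ 𝓥 S 0 x b P ⇒ 𝓣 S 0 a b P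
  via a≢x b≢x r∈S = relay P (segments-solePath (net3-segments a b i j k) (inj₂ (≢-sym b≢x)))
                            (segments-solePath (net3-segments a b i j k) (inj₁ (≢-sym a≢x))) r∈S
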